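{- Let $G$ be an $(n-3)$-regular graph of order $n\ge 7$ that is not the complete multipartite graph $K_{3,3,\ldots,3}$ (all parts of size $3$), and let $B$ be a Roman bondage set of $G$. Let $x,w\in V(G)$ with $xw\in E(G)$. If $E_G(x)\cap B=E_G(w)\cap B=\{xw\}$, then $|B|\ge n-2$.
   Context: All graphs are finite, simple and undirected. For a vertex $x$, $E_G(x)$ denotes the set of edges of $G$ incident with $x$. A Roman dominating function on $G=(V,E)$ is a function $f:V\to\{0,1,2\}$ such that every vertex $u$ with $f(u)=0$ is adjacent to some vertex $v$ with $f(v)=2$; its weight is $\sum_{u\in V}f(u)$, and $\gamma_{\rm R}(G)$ is the minimum weight of a Roman dominating function on $G$. A Roman bondage set of $G$ is a set $B\subseteq E(G)$ with $\gamma_{\rm R}(G-B)>\gamma_{\rm R}(G)$. -}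

module Defs where

open import Data.Nat using (ℕ; _+_; _≤_; _<_; _∸_)
open import Data.Bool using (Bool; true; false; _∧_; not; if_then_else_)
open import Data.Fin using (Fin; toℕ)
import Data.Fin as Fin
open import Data.List using (List; map; allFin; filter; length)
open import Data.Nat.ListAction using (sum)
open import Data.Nat.Properties using (_<?_)
open import Data.Product using (Σ; _×_; _,_)
open import Relation.Binary.PropositionalEquality using (_≡_; _≢_; cong; cong₂)
open import Relation.Nullary using (¬_)
open import Relation.Nullary.Decidable using (⌊_⌋)
open import Function.Bundles using (_⇔_)

record Graph (n : ℕ) : Set where
  field
    adj   : Fin n → Fin n → Bool
    sym   : ∀ i j → adj i j ≡ adj j i
    irref : ∀ i → adj i i ≡ false
open Graph public

countB : ∀ {n} → (Fin n → Bool) → ℕ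
countB {n} p = length (filter (λ i → p i Data.Bool.≟ true) (allFin n))

deg : ∀ {n} → Graph n → Fin n → ℕ
deg G x = countB (adj G x)

Regular : ∀ {n} → Graph n → ℕ → Set
Regular G r = ∀ x → deg G x ≡ r

IsK333 : ∀ {n} → Graph n → Set
IsK333 {n} G = Σ (Fin n → ℕ) λ part →
    (∀ i → countB (λ j → ⌊ part j Data.Nat.≟ part i ⌋) ≡ 3)
  × (∀ i j → (adj G i j ≡ true) ⇔ (part i ≢ part j))

record EdgeSet {n : ℕ} (G : Graph n) : Set where
  field
    mem    : Fin n → Fin n → Bool
    memSym : ∀ i j → mem i j ≡ mem j i
    sub    : ∀ i j → mem i j ≡ true → adj G i j ≡ true
open EdgeSet public

size : ∀ {n} {G : Graph n} → EdgeSet G → ℕ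
size {n} B = sum (map (λ i → countB (λ j → ⌊ toℕ i <? toℕ j ⌋ ∧ mem B i j)) (allFin n))

removeEdges : ∀ {n} (G : Graph n) → EdgeSet G → Graph n
removeEdges G B = record
  { adj   = λ i j → adj G i j ∧ not (mem B i j)
  ; sym   = λ i j → cong₂ (λ a b → a ∧ not b) (Graph.sym G i j) (memSym B i j)
  ; irref = λ i → cong (λ a → a ∧ not (mem B i i)) (irref G i)
  }

IsRDF : ∀ {n} → Graph n → (Fin n → Fin 3) → Set
IsRDF {n} G f = ∀ u → f u ≡ Fin.zero →
  Σ (Fin n) λ v → (adj G u v ≡ true) × (f v ≡ Fin.suc (Fin.suc Fin.zero))

weight : ∀ {n} → (Fin n → Fin 3) → ℕ
weight {n} f = sum (map (λ u → toℕ (f u)) (allFin n))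

RomanDomNumber : ∀ {n} → Graph n → ℕ → Set
RomanDomNumber G k =
  (Σ (Fin _ → Fin 3) λ f → IsRDF G f × (weight f ≡ k))
  × (∀ f → IsRDF G f → k ≤ weight f)

IsRomanBondageSet : ∀ {n} (G : Graph n) → EdgeSet G → Set
IsRomanBondageSet G B = ∀ k k' →
  RomanDomNumber G k → RomanDomNumber (removeEdges G B) k' → k < k'

module Submission where

-- Call z missing from u when u ≠ z are non-adjacent in G − B. In an (n − 3)-regular graph every
-- vertex has exactly two non-neighbours, which forces γ_R(G) ≥ 4; since B is a bondage set, no pair
-- {u, v} dominates G − B (2 on u and v would give γ_R(G − B) ≤ 4), so any two vertices have a
-- common missing vertex. For x and w this is a common non-neighbour a; let b and d be the other
-- non-neighbours of x and w. Further common missing vertices show that every v ∉ {x, w, a} is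
-- joined in B to one of a, b, d, with at most one exception s, for which B has yet another edge.
-- Charging a to xw, s to that edge, and every other v to its edge to the first of a, b, d it is
-- joined to ("its spoke") assigns distinct edges of B to the n − 2 vertices other than x and w.

open import Defs
open import Data.Bool using (Bool; true; false; _∧_; _∨_; not; if_then_else_)
import Data.Bool
open import Data.Bool.Properties using (not-injective; ∨-zeroʳ; ∧-identityʳ)
open import Data.Empty using (⊥; ⊥-elim)
open import Data.Fin using (Fin; toℕ; _≟_; finToFun; funToFin)
import Data.Fin as Fin
open import Data.Fin.Patterns using (0F; 1F; 2F)
open import Data.Fin.Properties using (any?; all?; finToFun-funToFin; toℕ-injective; pigeonhole; ¬∀⟶∃¬)
open import Data.List using (List; _∷_; []; map; allFin; tabulate; filter; length; lookup)
open import Data.List.Extrema.Nat using (argmin; argmin-all; f[argmin]≤f[xs])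
open import Data.List.Membership.Propositional using (_∈_; _∉_)
open import Data.List.Membership.Propositional.Properties using (∈-filter⁺; ∈-map⁺; ∈-allFin)
open import Data.List.Properties using (map-tabulate)
import Data.List.Relation.Unary.All as All
open import Data.List.Relation.Unary.All.Properties using (all-filter)
import Data.List.Relation.Unary.Any as Any
open import Data.List.Relation.Unary.Any using (here; there)
open import Data.List.Relation.Unary.Any.Properties using (lookup-index)
open import Data.Nat using (ℕ; zero; suc; _+_; _^_; _≤_; _<_; _∸_; _<?_; z≤n; s≤s)
import Data.Nat.ListAction as List
open import Data.Nat.Properties
  using ( +-0-commutativeMonoid; +-commutativeSemigroup; +-assoc; +-identityʳ; +-cancelˡ-≡; +-mono-≤; +-monoʳ-≤
        ; m≤m+n; m∸n+n≡m; m+n∸m≡n; suc-injective; ≤-refl; ≤-trans; ≤-antisym; <-irrefl; ≮⇒≥; module ≤-Reasoning)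
open import Algebra.Properties.CommutativeMonoid.Sum +-0-commutativeMonoid
  using (sum; sum-cong-≗; ∑-distrib-+; ∑-comm; sum-replicate-zero)
open import Algebra.Properties.CommutativeSemigroup +-commutativeSemigroup using (x∙yz≈y∙xz)
open import Data.Product using (∃; ∃₂; _×_; _,_; proj₁; proj₂; uncurry)
import Data.Sum
open import Data.Sum using (_⊎_; inj₁; inj₂; [_,_])
open import Function using (_∘_; id; flip)
open import Function.Bundles using (_⇔_; mk⇔; Equivalence)
open import Relation.Binary.PropositionalEquality hiding (sym; [_])
import Relation.Binary.PropositionalEquality as ≡
open import Relation.Nullary using (¬_; Dec; yes; no; does; contradiction)
open import Relation.Nullary.Decidable
  using (⌊_⌋; dec-true; dec-false; map′; _×-dec_; _⊎-dec_; _→-dec_; ¬?)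

-- Finite sums and counting

sum-tabulate : ∀ {n} (f : Fin n → ℕ) → List.sum (tabulate f) ≡ sum f
sum-tabulate {zero}  f = refl
sum-tabulate {suc n} f = cong (f Fin.zero +_) (sum-tabulate (f ∘ Fin.suc))

sum-map-allFin : ∀ {n} (f : Fin n → ℕ) → List.sum (map f (allFin n)) ≡ sum f
sum-map-allFin f = trans (cong List.sum (map-tabulate id f)) (sum-tabulate f)

sum-mono-≤ : ∀ {n} {f g : Fin n → ℕ} → (∀ i → f i ≤ g i) → sum f ≤ sum g
sum-mono-≤ {zero}  f≤g = z≤n
sum-mono-≤ {suc n} f≤g = +-mono-≤ (f≤g Fin.zero) (sum-mono-≤ (f≤g ∘ Fin.suc))

_without_ : ∀ {n} → (Fin n → ℕ) → Fin n → Fin n → ℕ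
(f without c) i = if does (i ≟ c) then 0 else f i

sum-without : ∀ {n} (f : Fin n → ℕ) c → sum f ≡ f c + sum (f without c)
sum-without f Fin.zero    = refl
sum-without f (Fin.suc c) = begin
  f₀ + sum (f ∘ Fin.suc)                               ≡⟨ cong (f₀ +_) (sum-without (f ∘ Fin.suc) c) ⟩
  f₀ + (f (Fin.suc c) + sum ((f ∘ Fin.suc) without c)) ≡⟨ x∙yz≈y∙xz f₀ (f (Fin.suc c)) _ ⟩
  f (Fin.suc c) + sum (f without Fin.suc c)            ∎
  where
  open ≡-Reasoning
  f₀ = f Fin.zero

without-≢ : ∀ {n} (f : Fin n → ℕ) {c i} → i ≢ c → (f without c) i ≡ f i
without-≢ f {c} {i} i≢c rewrite dec-false (i ≟ c) i≢c = refl

≤-sum : ∀ {n} (f : Fin n → ℕ) c → f c ≤ sum f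
≤-sum f c = subst (f c ≤_) (≡.sym (sum-without f c)) (m≤m+n (f c) _)

+-≤-sum : ∀ {n} (f : Fin n → ℕ) {u v} → u ≢ v → f u + f v ≤ sum f
+-≤-sum f {u} {v} u≢v = begin
  f u + f v                 ≡⟨ cong (f u +_) (without-≢ f (≢-sym u≢v)) ⟨
  f u + (f without u) v     ≤⟨ +-monoʳ-≤ (f u) (≤-sum (f without u) v) ⟩
  f u + sum (f without u)   ≡⟨ sum-without f u ⟨
  sum f                     ∎
  where open ≤-Reasoning

+-+-≤-sum : ∀ {n} (f : Fin n → ℕ) {u v t} → u ≢ v → u ≢ t → v ≢ t → f u + f v + f t ≤ sum f
+-+-≤-sum f {u} {v} {t} u≢v u≢t v≢t = begin
  f u + f v + f t                               ≡⟨ +-assoc (f u) (f v) (f t) ⟩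
  f u + (f v + f t)                             ≡⟨ cong₂ (λ p q → f u + (p + q)) (without-≢ f (≢-sym u≢v))
                                                                                (without-≢ f (≢-sym u≢t)) ⟨
  f u + ((f without u) v + (f without u) t)     ≤⟨ +-monoʳ-≤ (f u) (+-≤-sum (f without u) v≢t) ⟩
  f u + sum (f without u)                       ≡⟨ sum-without f u ⟨
  sum f                                         ∎
  where open ≤-Reasoning

≡true⇒≢false : ∀ {b} → b ≡ true → b ≢ false
≡true⇒≢false refl ()

χ : Bool → ℕ
χ true  = 1
χ false = 0

sum-const-1 : ∀ n → sum {n} (λ _ → 1) ≡ n
sum-const-1 zero    = refl
sum-const-1 (suc n) = cong suc (sum-const-1 n)

countB-tabulate : ∀ {m n} (p : Fin n → Bool) (g : Fin m → Fin n) →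
  length (filter (λ i → p i Data.Bool.≟ true) (tabulate g)) ≡ sum (χ ∘ p ∘ g)
countB-tabulate {zero}  p g = refl
countB-tabulate {suc m} p g with p (g Fin.zero)
... | true  = cong suc (countB-tabulate p (g ∘ Fin.suc))
... | false = countB-tabulate p (g ∘ Fin.suc)

countB-sum : ∀ {n} (p : Fin n → Bool) → countB p ≡ sum (χ ∘ p)
countB-sum p = countB-tabulate p id

countB-complement : ∀ {n} (p : Fin n → Bool) → countB p + countB (not ∘ p) ≡ n
countB-complement {n} p = begin
  countB p + countB (not ∘ p)               ≡⟨ cong₂ _+_ (countB-sum p) (countB-sum (not ∘ p)) ⟩
  sum (χ ∘ p) + sum (χ ∘ not ∘ p)           ≡⟨ ∑-distrib-+ (χ ∘ p) (χ ∘ not ∘ p) ⟨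
  sum (λ i → χ (p i) + χ (not (p i)))       ≡⟨ sum-cong-≗ (χ-+-χ-not ∘ p) ⟩
  sum {n} (λ _ → 1)                         ≡⟨ sum-const-1 n ⟩
  n                                         ∎
  where
  open ≡-Reasoning
  χ-+-χ-not : ∀ b → χ b + χ (not b) ≡ 1
  χ-+-χ-not true  = refl
  χ-+-χ-not false = refl

_─_ : ∀ {n} → (Fin n → Bool) → Fin n → Fin n → Bool
(p ─ c) i = p i ∧ not (does (i ≟ c))

─-true : ∀ {n} (p : Fin n → Bool) {c i} → (p ─ c) i ≡ true ⇔ (p i ≡ true × i ≢ c)
─-true p {c} {i} with p i | i ≟ c
... | true  | yes i≡c = mk⇔ (λ ()) (λ (_ , i≢c) → contradiction i≡c i≢c)
... | true  | no  i≢c = mk⇔ (λ _ → refl , i≢c) (λ _ → refl)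
... | false | _       = mk⇔ (λ ()) (λ ())

countB-─ : ∀ {n} (p : Fin n → Bool) {c} → p c ≡ true → countB p ≡ suc (countB (p ─ c))
countB-─ p {c} pc = begin
  countB p                           ≡⟨ countB-sum p ⟩
  sum (χ ∘ p)                        ≡⟨ sum-without (χ ∘ p) c ⟩
  χ (p c) + sum ((χ ∘ p) without c)  ≡⟨ cong₂ _+_ (cong χ pc) (sum-cong-≗ χ-without) ⟩
  suc (sum (χ ∘ (p ─ c)))            ≡⟨ cong suc (countB-sum (p ─ c)) ⟨
  suc (countB (p ─ c))               ∎
  where
  open ≡-Reasoning
  χ-without : ∀ i → ((χ ∘ p) without c) i ≡ χ ((p ─ c) i)
  χ-without i with p i | i ≟ c
  ... | true  | yes _ = refl
  ... | true  | no  _ = refl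
  ... | false | yes _ = refl
  ... | false | no  _ = refl

countB-witness : ∀ {n} (p : Fin n → Bool) → 0 < countB p → ∃ λ i → p i ≡ true
countB-witness {n} p 0<count with any? (λ i → p i Data.Bool.≟ true)
... | yes witness = witness
... | no  none    = contradiction (subst (0 <_) countB≡0 0<count) (λ ())
  where
  χ∘p≗0 : ∀ i → χ (p i) ≡ 0
  χ∘p≗0 i with p i in pi≡
  ... | true  = contradiction (i , pi≡) none
  ... | false = refl
  countB≡0 : countB p ≡ 0
  countB≡0 = trans (countB-sum p) (trans (sum-cong-≗ χ∘p≗0) (sum-replicate-zero n))

countB-all-but-two : ∀ {n} {x w : Fin n} → x ≢ w → countB (((λ _ → true) ─ x) ─ w) ≡ n ∸ 2
countB-all-but-two {n} {x} {w} x≢w = begin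
  countB (((λ _ → true) ─ x) ─ w)             ≡⟨ m+n∸m≡n 2 _ ⟨
  2 + countB (((λ _ → true) ─ x) ─ w) ∸ 2     ≡⟨ cong (λ c → suc c ∸ 2) (countB-─ ((λ _ → true) ─ x) {w} w∈all─x) ⟨
  suc (countB ((λ _ → true) ─ x)) ∸ 2         ≡⟨ cong (_∸ 2) (countB-─ (λ _ → true) {x} refl) ⟨
  countB {n} (λ _ → true) ∸ 2                 ≡⟨ cong (_∸ 2) (trans (countB-sum {n} (λ _ → true)) (sum-const-1 n)) ⟩
  n ∸ 2                                       ∎
  where
  open ≡-Reasoning
  w∈all─x : ((λ _ → true) ─ x) w ≡ true
  w∈all─x = Equivalence.from (─-true (λ _ → true) {x} {w}) (refl , ≢-sym x≢w)

countB-2⇒pair : ∀ {n} (p : Fin n → Bool) → countB p ≡ 2 → ∃₂ λ a b → a ≢ b × p a ≡ true × p b ≡ true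
countB-2⇒pair p count≡2 with countB-witness p (subst (0 <_) (≡.sym count≡2) (s≤s z≤n))
... | a , pa with countB-witness (p ─ a)
                   (subst (0 <_) (≡.sym (suc-injective (trans (≡.sym (countB-─ p pa)) count≡2))) (s≤s z≤n))
... | b , p─a-b = let (pb , b≢a) = Equivalence.to (─-true p) p─a-b in a , b , ≢-sym b≢a , pa , pb

3≤countB : ∀ {n} (p : Fin n → Bool) {u v t} → u ≢ v → u ≢ t → v ≢ t →
  p u ≡ true → p v ≡ true → p t ≡ true → 3 ≤ countB p
3≤countB p {u} {v} {t} u≢v u≢t v≢t pu pv pt = begin
  3                            ≡⟨ cong₂ _+_ (cong₂ _+_ (cong χ pu) (cong χ pv)) (cong χ pt) ⟨
  χ (p u) + χ (p v) + χ (p t)  ≤⟨ +-+-≤-sum (χ ∘ p) u≢v u≢t v≢t ⟩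
  sum (χ ∘ p)                  ≡⟨ countB-sum p ⟨
  countB p                     ∎
  where open ≤-Reasoning

sum-χ-≟-∧ : ∀ {n} (c : Fin n) b → sum (λ v → χ (does (v ≟ c) ∧ b)) ≡ χ b
sum-χ-≟-∧ {n} c b = begin
  sum f                     ≡⟨ sum-without f c ⟩
  f c + sum (f without c)   ≡⟨ cong₂ _+_ (cong (λ t → χ (t ∧ b)) (dec-true (c ≟ c) refl)) (sum-cong-≗ rest≗0) ⟩
  χ b + sum {n} (λ _ → 0)   ≡⟨ cong (χ b +_) (sum-replicate-zero n) ⟩
  χ b + 0                   ≡⟨ +-identityʳ (χ b) ⟩
  χ b                       ∎
  where
  open ≡-Reasoning
  f : Fin n → ℕ
  f v = χ (does (v ≟ c) ∧ b)
  rest≗0 : ∀ v → (f without c) v ≡ 0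
  rest≗0 v with v ≟ c
  ... | yes _ = refl
  ... | no  _ = refl

fresh : ∀ {n} (xs : List (Fin n)) → length xs < n → ∃ λ z → z ∉ xs
fresh {n} xs |xs|<n with all? (λ z → Any.any? (z ≟_) xs)
... | no  ¬all = ¬∀⟶∃¬ n (_∈ xs) (λ z → Any.any? (z ≟_) xs) ¬all
... | yes all  = ⊥-elim (collision (pigeonhole |xs|<n position))
  where
  position : Fin n → Fin (length xs)
  position z = Any.index (all z)
  collision : (∃₂ λ i j → i Fin.< j × position i ≡ position j) → ⊥
  collision (i , j , i<j , same) = <-irrefl (cong toℕ i≡j) i<j
    where
    i≡j : i ≡ j
    i≡j = trans (lookup-index (all i)) (trans (cong (lookup xs) same) (≡.sym (lookup-index (all j))))

-- Non-neighbours in (n − 3)-regular graphs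

NonNeighbour : ∀ {n} → Graph n → Fin n → Fin n → Set
NonNeighbour G v z = v ≢ z × adj G v z ≡ false

nonNeighbour-sym : ∀ {n} (G : Graph n) {v z} → NonNeighbour G v z → NonNeighbour G z v
nonNeighbour-sym G (v≢z , vz) = ≢-sym v≢z , trans (Graph.sym G _ _) vz

adjacent-nonNeighbour-≢ : ∀ {n} (G : Graph n) {v p q} → adj G v p ≡ true → NonNeighbour G v q → p ≢ q
adjacent-nonNeighbour-≢ G vp (_ , vq) refl = ≡true⇒≢false vp vq

TwoNonNeighbours : ∀ {n} → Graph n → Fin n → Set
TwoNonNeighbours G v = ∃₂ λ a b → a ≢ b × NonNeighbour G v a × NonNeighbour G v b

module CoRegular {n} (3≤n : 3 ≤ n) (G : Graph n) (regular : Regular G (n ∸ 3)) where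

  nonNeighbours : Fin n → Fin n → Bool
  nonNeighbours v = (not ∘ adj G v) ─ v

  nonNeighbours-true : ∀ {v z} → nonNeighbours v z ≡ true ⇔ NonNeighbour G v z
  nonNeighbours-true {v} {z} = mk⇔
    (λ nn → let (¬adj , z≢v) = Equivalence.to (─-true (not ∘ adj G v)) nn in ≢-sym z≢v , not-injective ¬adj)
    (λ (v≢z , ¬adj) → Equivalence.from (─-true (not ∘ adj G v)) (cong not ¬adj , ≢-sym v≢z))

  countB-nonAdjacent : ∀ v → countB (not ∘ adj G v) ≡ 3
  countB-nonAdjacent v = +-cancelˡ-≡ (n ∸ 3) _ _ (begin
    n ∸ 3 + countB (not ∘ adj G v)    ≡⟨ cong (_+ countB (not ∘ adj G v)) (regular v) ⟨
    deg G v + countB (not ∘ adj G v)  ≡⟨ countB-complement (adj G v) ⟩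
    n                                 ≡⟨ m∸n+n≡m 3≤n ⟨
    n ∸ 3 + 3                         ∎)
    where open ≡-Reasoning

  countB-nonNeighbours : ∀ v → countB (nonNeighbours v) ≡ 2
  countB-nonNeighbours v =
    suc-injective (trans (≡.sym (countB-─ (not ∘ adj G v) (cong not (irref G v)))) (countB-nonAdjacent v))

  -- opaque, so that with-abstractions over its consequences do not unfold the counting argument
  opaque
    twoNonNeighbours : ∀ v → TwoNonNeighbours G v
    twoNonNeighbours v =
      let (a , b , a≢b , nn-a , nn-b) = countB-2⇒pair (nonNeighbours v) (countB-nonNeighbours v)
      in a , b , a≢b , to nn-a , to nn-b
      where
      to : ∀ {z} → nonNeighbours v z ≡ true → NonNeighbour G v z
      to = Equivalence.to nonNeighbours-true

  no-three-nonNeighbours : ∀ {v p q r} → p ≢ q → p ≢ r → q ≢ r →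
    NonNeighbour G v p → NonNeighbour G v q → NonNeighbour G v r → ⊥
  no-three-nonNeighbours {v} p≢q p≢r q≢r nn-p nn-q nn-r = <-irrefl refl (begin-strict
    2                         <⟨ 3≤countB (nonNeighbours v) p≢q p≢r q≢r (from nn-p) (from nn-q) (from nn-r) ⟩
    countB (nonNeighbours v)  ≡⟨ countB-nonNeighbours v ⟩
    2                         ∎)
    where
    open ≤-Reasoning
    from : ∀ {z} → NonNeighbour G v z → nonNeighbours v z ≡ true
    from = Equivalence.from nonNeighbours-true

  nonNeighbour-either : ∀ {v p q z} → p ≢ q → NonNeighbour G v p → NonNeighbour G v q →
    NonNeighbour G v z → z ≡ p ⊎ z ≡ q
  nonNeighbour-either {p = p} {q = q} {z = z} p≢q nn-p nn-q nn-z with z ≟ p | z ≟ q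
  ... | yes z≡p | _       = inj₁ z≡p
  ... | no  _   | yes z≡q = inj₂ z≡q
  ... | no  z≢p | no  z≢q = ⊥-elim (no-three-nonNeighbours p≢q (≢-sym z≢p) (≢-sym z≢q) nn-p nn-q nn-z)

  other-nonNeighbour : ∀ {v t} → NonNeighbour G v t → ∃ λ b → t ≢ b × NonNeighbour G v b
  other-nonNeighbour {v} {t} nn-t = other (twoNonNeighbours v)
    where
    other : TwoNonNeighbours G v → ∃ λ b → t ≢ b × NonNeighbour G v b
    other (p , q , p≢q , nn-p , nn-q) with nonNeighbour-either p≢q nn-p nn-q nn-t
    ... | inj₁ refl = q , p≢q , nn-q
    ... | inj₂ refl = p , ≢-sym p≢q , nn-p

-- Roman dominating functions

weight-sum : ∀ {n} (f : Fin n → Fin 3) → weight f ≡ sum (toℕ ∘ f)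
weight-sum f = sum-map-allFin (toℕ ∘ f)

module _ {n} (G : Graph n) (f : Fin n → Fin 3) (rdf : IsRDF G f) where

  private
    w = sum (toℕ ∘ f)

  4≤weight-via-0 : ∀ {v c} → f v ≡ 2F → adj G v c ≡ false → f c ≡ 0F → 4 ≤ w
  4≤weight-via-0 {v} {c} fv≡2 vc fc≡0 with rdf c fc≡0
  ... | u , cu , fu≡2 = subst (_≤ w) (cong₂ (λ p q → toℕ p + toℕ q) fv≡2 fu≡2) (+-≤-sum (toℕ ∘ f) v≢u)
    where
    v≢u : v ≢ u
    v≢u refl = ≡true⇒≢false cu (trans (Graph.sym G c v) vc)

  4≤weight : 4 ≤ n → (∀ v → TwoNonNeighbours G v) → 4 ≤ weight f
  4≤weight 4≤n two-nn = subst (4 ≤_) (≡.sym (weight-sum f)) (by-cases (any? (λ v → f v Fin.≟ 2F)))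
    where
    open ≤-Reasoning
    by-cases : Dec (∃ λ v → f v ≡ 2F) → 4 ≤ w
    by-cases (no no-two) = begin
      4                  ≤⟨ 4≤n ⟩
      n                  ≡⟨ sum-const-1 n ⟨
      sum {n} (λ _ → 1)  ≤⟨ sum-mono-≤ positive ⟩
      w                  ∎
      where
      positive : ∀ u → 1 ≤ toℕ (f u)
      positive u with f u in fu
      ... | 0F        = contradiction (proj₁ (rdf u fu) , proj₂ (proj₂ (rdf u fu))) no-two
      ... | Fin.suc _ = s≤s z≤n
    by-cases (yes (v , fv≡2)) with two-nn v
    ... | a , b , a≢b , (v≢a , va) , (v≢b , vb) with f a in fa | f b in fb
    ...   | 0F        | _         = 4≤weight-via-0 fv≡2 va fa
    ...   | Fin.suc _ | 0F        = 4≤weight-via-0 fv≡2 vb fb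
    ...   | Fin.suc i | Fin.suc j = begin
      4                                      ≤⟨ +-mono-≤ (+-monoʳ-≤ 2 (s≤s z≤n)) (s≤s z≤n) ⟩
      2 + toℕ (Fin.suc i) + toℕ (Fin.suc j)  ≡⟨ cong₂ _+_ (cong₂ _+_ (cong toℕ fv≡2) (cong toℕ fa)) (cong toℕ fb) ⟨
      toℕ (f v) + toℕ (f a) + toℕ (f b)      ≤⟨ +-+-≤-sum (toℕ ∘ f) v≢a v≢b a≢b ⟩
      w                                      ∎

weight-cong : ∀ {n} {f g : Fin n → Fin 3} → (∀ i → f i ≡ g i) → weight f ≡ weight g
weight-cong {f = f} {g} f≗g = begin
  weight f         ≡⟨ weight-sum f ⟩
  sum (toℕ ∘ f)    ≡⟨ sum-cong-≗ (cong toℕ ∘ f≗g) ⟩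
  sum (toℕ ∘ g)    ≡⟨ weight-sum g ⟨
  weight g         ∎
  where open ≡-Reasoning

module _ {n} (G : Graph n) where

  isRDF? : ∀ f → Dec (IsRDF G f)
  isRDF? f = all? λ u → (f u Fin.≟ 0F) →-dec any? λ v → (adj G u v Data.Bool.≟ true) ×-dec (f v Fin.≟ 2F)

  isRDF-cong : ∀ {f g} → (∀ i → f i ≡ g i) → IsRDF G f → IsRDF G g
  isRDF-cong f≗g rdf u gu≡0 with rdf u (trans (f≗g u) gu≡0)
  ... | v , uv , fv≡2 = v , uv , trans (≡.sym (f≗g v)) fv≡2

  romanDomNumber-exists : ∃ (RomanDomNumber G)
  romanDomNumber-exists = weight best , (best , best-isRDF , refl) , best-minimal
    where
    all-ones : Fin n → Fin 3
    all-ones _ = 1F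
    candidates : List (Fin n → Fin 3)
    candidates = filter isRDF? (map finToFun (allFin (3 ^ n)))
    best : Fin n → Fin 3
    best = argmin weight all-ones candidates
    best-isRDF : IsRDF G best
    best-isRDF = argmin-all weight {all-ones} {candidates} {P = IsRDF G} (λ _ ())
                   (all-filter isRDF? (map finToFun (allFin (3 ^ n))))
    best-minimal : ∀ g → IsRDF G g → weight best ≤ weight g
    best-minimal g g-isRDF = subst (weight best ≤_) (weight-cong (finToFun-funToFin g))
      (All.lookup (f[argmin]≤f[xs] {f = weight} all-ones candidates)
        (∈-filter⁺ isRDF? (∈-map⁺ finToFun (∈-allFin (funToFin g)))
          (isRDF-cong (≡.sym ∘ finToFun-funToFin g) g-isRDF)))

twoOn : ∀ {n} → Fin n → Fin n → Fin n → Fin 3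
twoOn u v i = if does (i ≟ u) ∨ does (i ≟ v) then 2F else 0F

module _ {n} {u v : Fin n} where

  twoOn-left : twoOn u v u ≡ 2F
  twoOn-left rewrite dec-true (u ≟ u) refl = refl

  twoOn-right : twoOn u v v ≡ 2F
  twoOn-right rewrite dec-true (v ≟ v) refl | ∨-zeroʳ (does (v ≟ u)) = refl

  weight-twoOn : u ≢ v → weight (twoOn u v) ≡ 4
  weight-twoOn u≢v = begin
    weight (twoOn u v)                            ≡⟨ weight-sum (twoOn u v) ⟩
    sum f                                         ≡⟨ sum-without f u ⟩
    f u + sum (f without u)                       ≡⟨ cong (f u +_) (sum-without (f without u) v) ⟩
    f u + ((f without u) v + sum rest)
      ≡⟨ cong₂ (λ p q → toℕ p + (q + sum rest)) twoOn-left (without-≢ f (≢-sym u≢v)) ⟩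
    2 + (toℕ (twoOn u v v) + sum rest)
      ≡⟨ cong₂ (λ p q → 2 + (toℕ p + q)) twoOn-right (trans (sum-cong-≗ rest≗0) (sum-replicate-zero n)) ⟩
    4                                             ∎
    where
    open ≡-Reasoning
    f = toℕ ∘ twoOn u v
    rest = (f without u) without v
    rest≗0 : ∀ i → rest i ≡ 0
    rest≗0 i with i ≟ v | i ≟ u
    ... | yes _   | _       = refl
    ... | no  _   | yes _   = refl
    ... | no  _   | no  _   = refl

  twoOn-isRDF : (H : Graph n) → (∀ z → z ≢ u → z ≢ v → adj H z u ≡ true ⊎ adj H z v ≡ true) →
    IsRDF H (twoOn u v)
  twoOn-isRDF H dominated z twoOn-z≡0
    with dominated z (λ { refl → contradiction (trans (≡.sym twoOn-left) twoOn-z≡0) λ () })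
                     (λ { refl → contradiction (trans (≡.sym twoOn-right) twoOn-z≡0) λ () })
  ... | inj₁ zu = u , zu , twoOn-left
  ... | inj₂ zv = v , zv , twoOn-right

-- Missing vertices in G − B

-- u and z are distinct and non-adjacent in G − B
Missing : ∀ {n} {G : Graph n} → EdgeSet G → Fin n → Fin n → Set
Missing {G = G} B u z = NonNeighbour G u z ⊎ mem B u z ≡ true

module _ {n} {G : Graph n} (B : EdgeSet G) where

  private
    G-B = removeEdges G B

  missing-sym : ∀ {u z} → Missing B u z → Missing B z u
  missing-sym {u} {z} (inj₁ (u≢z , uz)) = inj₁ (≢-sym u≢z , trans (Graph.sym G z u) uz)
  missing-sym {u} {z} (inj₂ uz∈B)       = inj₂ (trans (memSym B z u) uz∈B)

  missing⇒nonNeighbour : ∀ {u z} → Missing B u z → mem B u z ≡ false → NonNeighbour G u z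
  missing⇒nonNeighbour (inj₁ nn)   _    = nn
  missing⇒nonNeighbour (inj₂ uz∈B) uz∉B = ⊥-elim (≡true⇒≢false uz∈B uz∉B)

  nonAdjacent⇒missing : ∀ {u z} → u ≢ z → adj G-B u z ≡ false → Missing B u z
  nonAdjacent⇒missing {u} {z} u≢z uz with adj G u z | mem B u z
  ... | false | _    = inj₁ (u≢z , refl)
  ... | true  | true = inj₂ refl

  -- If {u, v} dominated G − B, the function 2 on u and v would make γ_R(G − B) ≤ 4 ≤ γ_R(G).
  common-missing : 4 ≤ n → (∀ v → TwoNonNeighbours G v) → IsRomanBondageSet G B →
    ∀ {u v} → u ≢ v → ∃ λ z → Missing B u z × Missing B v z
  common-missing 4≤n two-nn bondage {u} {v} u≢v
    with any? (λ z → ¬? (z ≟ u) ×-dec ¬? (z ≟ v)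
                     ×-dec (adj G-B z u Data.Bool.≟ false) ×-dec (adj G-B z v Data.Bool.≟ false))
  ... | yes (z , z≢u , z≢v , zu , zv) =
    z , nonAdjacent⇒missing (≢-sym z≢u) (trans (Graph.sym G-B u z) zu)
      , nonAdjacent⇒missing (≢-sym z≢v) (trans (Graph.sym G-B v z) zv)
  ... | no none = ⊥-elim (<-irrefl refl (begin-strict
      4                   ≤⟨ 4≤weight G f f-isRDF 4≤n two-nn ⟩
      weight f            ≡⟨ wf≡k ⟩
      k                   <⟨ bondage k k' γR-G γR-G-B ⟩
      k'                  ≤⟨ proj₂ γR-G-B (twoOn u v) (twoOn-isRDF G-B dominated) ⟩
      weight (twoOn u v)  ≡⟨ weight-twoOn u≢v ⟩
      4                   ∎))
    where
    open ≤-Reasoning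
    dominated : ∀ z → z ≢ u → z ≢ v → adj G-B z u ≡ true ⊎ adj G-B z v ≡ true
    dominated z z≢u z≢v with adj G-B z u in zu | adj G-B z v in zv
    ... | true  | _     = inj₁ refl
    ... | false | true  = inj₂ refl
    ... | false | false = contradiction (z , z≢u , z≢v , zu , zv) none
    k  = proj₁ (romanDomNumber-exists G)
    k' = proj₁ (romanDomNumber-exists G-B)
    γR-G   = proj₂ (romanDomNumber-exists G)
    γR-G-B = proj₂ (romanDomNumber-exists G-B)
    f = proj₁ (proj₁ γR-G)
    f-isRDF = proj₁ (proj₂ (proj₁ γR-G))
    wf≡k = proj₂ (proj₂ (proj₁ γR-G))

-- Injective assignments of edges

_<ᵇ_ : ∀ {n} → Fin n → Fin n → Bool
i <ᵇ j = ⌊ toℕ i <? toℕ j ⌋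

<ᵇ-connex : ∀ {n} {p q : Fin n} → p ≢ q → p <ᵇ q ≡ false → q <ᵇ p ≡ true
<ᵇ-connex {p = p} {q} p≢q p≮q with toℕ q <? toℕ p | toℕ p <? toℕ q
... | yes _   | _       = refl
... | no  q≮p | no  p≮q = contradiction (toℕ-injective (≤-antisym (≮⇒≥ q≮p) (≮⇒≥ p≮q))) p≢q

orient : ∀ {n} → Fin n → Fin n → Fin n × Fin n
orient p q = if p <ᵇ q then (p , q) else (q , p)

orient-spec : ∀ {n} {p q : Fin n} → p ≢ q →
  uncurry _<ᵇ_ (orient p q) ≡ true × (orient p q ≡ (p , q) ⊎ orient p q ≡ (q , p))
orient-spec {p = p} {q} p≢q with p <ᵇ q in p<q
... | true  = p<q , inj₁ refl
... | false = <ᵇ-connex p≢q p<q , inj₂ refl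

module _ {n} {G : Graph n} (B : EdgeSet G) where

  Encodes : (Fin n → Fin n → Fin n) → Fin n → Fin n → Fin n → Set
  Encodes decode v p q = mem B p q ≡ true × decode p q ≡ v × decode q p ≡ v

  encodes-swap : ∀ {decode v p q} → Encodes decode v p q → Encodes decode v q p
  encodes-swap {p = p} {q} (pq∈B , pq↦v , qp↦v) = trans (memSym B q p) pq∈B , qp↦v , pq↦v

  mem⇒≢ : ∀ {p q} → mem B p q ≡ true → p ≢ q
  mem⇒≢ {p} pp∈B refl = ≡true⇒≢false (sub B p p pp∈B) (irref G p)

  size-sum : size B ≡ sum (λ i → sum (λ j → χ (i <ᵇ j ∧ mem B i j)))
  size-sum = trans (sum-map-allFin (λ i → countB (λ j → i <ᵇ j ∧ mem B i j)))
                   (sum-cong-≗ (λ i → countB-sum (λ j → i <ᵇ j ∧ mem B i j)))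

  -- size B counts each edge once, in the orientation chosen by orient; since decode recovers v
  -- from either orientation of its edge, the assignment is injective
  countB≤size : (S : Fin n → Bool) (decode : Fin n → Fin n → Fin n) (e₁ e₂ : Fin n → Fin n) →
    (∀ v → S v ≡ true → Encodes decode v (e₁ v) (e₂ v)) → countB S ≤ size B
  countB≤size S decode e₁ e₂ encodes = begin
    countB S                                               ≡⟨ countB-sum S ⟩
    sum (χ ∘ S)                                            ≤⟨ sum-mono-≤ χS≤hits ⟩
    sum (λ v → sum (λ i → sum (λ j → χ (hit v i j))))      ≡⟨ ∑-comm (λ v i → sum (λ j → χ (hit v i j))) ⟩
    sum (λ i → sum (λ v → sum (λ j → χ (hit v i j))))      ≡⟨ sum-cong-≗ (λ i → ∑-comm (λ v j → χ (hit v i j))) ⟩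
    sum (λ i → sum (λ j → sum (λ v → χ (hit v i j))))      ≤⟨ sum-mono-≤ (λ i → sum-mono-≤ (hits≤edge i)) ⟩
    sum (λ i → sum (λ j → χ (i <ᵇ j ∧ mem B i j)))         ≡⟨ size-sum ⟨
    size B                                                 ∎
    where
    open ≤-Reasoning
    lo hi : Fin n → Fin n
    lo v = proj₁ (orient (e₁ v) (e₂ v))
    hi v = proj₂ (orient (e₁ v) (e₂ v))

    hit : Fin n → Fin n → Fin n → Bool
    hit v i j = S v ∧ (does (i ≟ lo v) ∧ does (j ≟ hi v))

    hit-true : ∀ {v i j} → hit v i j ≡ true → S v ≡ true × i ≡ lo v × j ≡ hi v
    hit-true {v} {i} {j} h with S v | i ≟ lo v | j ≟ hi v
    ... | true | yes i≡lo | yes j≡hi = refl , i≡lo , j≡hi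

    oriented : ∀ v → S v ≡ true → lo v <ᵇ hi v ≡ true × Encodes decode v (lo v) (hi v)
    oriented v Sv with orient-spec (mem⇒≢ (proj₁ (encodes v Sv)))
    ... | lo<hi , inj₁ lo,hi≡ = lo<hi , subst (uncurry (Encodes decode v)) (≡.sym lo,hi≡) (encodes v Sv)
    ... | lo<hi , inj₂ lo,hi≡ =
      lo<hi , subst (uncurry (Encodes decode v)) (≡.sym lo,hi≡) (encodes-swap {decode} (encodes v Sv))

    χS≤hits : ∀ v → χ (S v) ≤ sum (λ i → sum (λ j → χ (hit v i j)))
    χS≤hits v = begin
      χ (S v)                               ≡⟨ cong χ (∧-identityʳ (S v)) ⟨
      χ (S v ∧ (true ∧ true))               ≡⟨ cong₂ (λ s t → χ (S v ∧ (s ∧ t)))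
                                                       (dec-true (lo v ≟ lo v) refl) (dec-true (hi v ≟ hi v) refl) ⟨
      χ (hit v (lo v) (hi v))               ≤⟨ ≤-sum (λ j → χ (hit v (lo v) j)) (hi v) ⟩
      sum (λ j → χ (hit v (lo v) j))        ≤⟨ ≤-sum (λ i → sum (λ j → χ (hit v i j))) (lo v) ⟩
      sum (λ i → sum (λ j → χ (hit v i j))) ∎

    hit≤decoded : ∀ v i j → χ (hit v i j) ≤ χ (does (v ≟ decode i j) ∧ (i <ᵇ j ∧ mem B i j))
    hit≤decoded v i j with hit v i j in h
    ... | false = z≤n
    ... | true with hit-true {v} {i} {j} h
    ...   | Sv , refl , refl with oriented v Sv
    ...     | lo<hi , lohi∈B , lohi↦v , _ rewrite lo<hi | lohi∈B | lohi↦v | dec-true (v ≟ v) refl = ≤-refl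

    hits≤edge : ∀ i j → sum (λ v → χ (hit v i j)) ≤ χ (i <ᵇ j ∧ mem B i j)
    hits≤edge i j = begin
      sum (λ v → χ (hit v i j))                                      ≤⟨ sum-mono-≤ (λ v → hit≤decoded v i j) ⟩
      sum (λ v → χ (does (v ≟ decode i j) ∧ (i <ᵇ j ∧ mem B i j)))   ≡⟨ sum-χ-≟-∧ (decode i j) (i <ᵇ j ∧ mem B i j) ⟩
      χ (i <ᵇ j ∧ mem B i j)                                         ∎

module Spokes {n} {G : Graph n} (B : EdgeSet G) (x w a b d : Fin n) where

  hub : Fin n → Fin n
  hub p = if mem B p a then a else if mem B p b then b else d

  hub-a : ∀ {p} → mem B p a ≡ true → hub p ≡ a
  hub-a pa∈B rewrite pa∈B = refl

  hub-d : ∀ {p} → mem B p a ≡ false → mem B p b ≡ false → hub p ≡ d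
  hub-d pa∉B pb∉B rewrite pa∉B | pb∉B = refl

  hub-range : ∀ p → hub p ≡ a ⊎ hub p ≡ b ⊎ hub p ≡ d
  hub-range p with mem B p a | mem B p b
  ... | true  | _     = inj₁ refl
  ... | false | true  = inj₂ (inj₁ refl)
  ... | false | false = inj₂ (inj₂ refl)

  Spoke : Fin n → Fin n → Set
  Spoke p q = q ≡ hub p × p ≢ a

  XW : Fin n → Fin n → Set
  XW p q = (p ≡ x × q ≡ w) ⊎ (p ≡ w × q ≡ x)

  ¬XW : ∀ {p q} → p ≢ x → p ≢ w → ¬ XW p q × ¬ XW q p
  ¬XW p≢x p≢w = [ p≢x ∘ proj₁ , p≢w ∘ proj₁ ] , [ p≢w ∘ proj₂ , p≢x ∘ proj₂ ]

  xw? : ∀ p q → Dec (XW p q)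
  xw? p q = ((p ≟ x) ×-dec (q ≟ w)) ⊎-dec ((p ≟ w) ×-dec (q ≟ x))

  spoke? : ∀ p q → Dec (Spoke p q)
  spoke? p q = (q ≟ hub p) ×-dec ¬? (p ≟ a)

  hub∈B : ∀ {p} → mem B p a ≡ true ⊎ mem B p b ≡ true ⊎ mem B p d ≡ true → mem B p (hub p) ≡ true
  hub∈B {p} pa∈B⊎ with mem B p a in pa | mem B p b in pb | pa∈B⊎
  ... | true  | _     | _                  = pa
  ... | false | true  | _                  = pb
  ... | false | false | inj₂ (inj₂ pd∈B)   = pd∈B

  ¬spoke-to : ∀ {p q} → hub p ≢ q → ¬ Spoke p q
  ¬spoke-to hub≢q (q≡hub , _) = hub≢q (≡.sym q≡hub)

  ¬spoke-to-other : ∀ {p q} → q ≢ a → q ≢ b → q ≢ d → ¬ Spoke p q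
  ¬spoke-to-other {p} q≢a q≢b q≢d (q≡hub , _) with hub-range p
  ... | inj₁ hub≡a        = q≢a (trans q≡hub hub≡a)
  ... | inj₂ (inj₁ hub≡b) = q≢b (trans q≡hub hub≡b)
  ... | inj₂ (inj₂ hub≡d) = q≢d (trans q≡hub hub≡d)

  module _ (s : Fin n) where

    decode : Fin n → Fin n → Fin n
    decode p q =
      if does (xw? p q) then a else if does (spoke? p q) then p else if does (spoke? q p) then q else s

    decode-xw : decode x w ≡ a
    decode-xw rewrite dec-true (xw? x w) (inj₁ (refl , refl)) = refl

    decode-wx : decode w x ≡ a
    decode-wx rewrite dec-true (xw? w x) (inj₂ (refl , refl)) = refl

    decode-spoke : ∀ {p q} → ¬ XW p q → Spoke p q → decode p q ≡ p
    decode-spoke {p} {q} ¬xw spoke rewrite dec-false (xw? p q) ¬xw | dec-true (spoke? p q) spoke = refl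

    decode-spoke-flipped : ∀ {p q} → ¬ XW q p → ¬ Spoke q p → Spoke p q → decode q p ≡ p
    decode-spoke-flipped {p} {q} ¬xw ¬spoke spoke
      rewrite dec-false (xw? q p) ¬xw | dec-false (spoke? q p) ¬spoke | dec-true (spoke? p q) spoke = refl

    decode-other : ∀ {p q} → ¬ XW p q → ¬ Spoke p q → ¬ Spoke q p → decode p q ≡ s
    decode-other {p} {q} ¬xw ¬pq ¬qp
      rewrite dec-false (xw? p q) ¬xw | dec-false (spoke? p q) ¬pq | dec-false (spoke? q p) ¬qp = refl

    encodes-xw : mem B x w ≡ true → Encodes B decode a x w
    encodes-xw xw∈B = xw∈B , decode-xw , decode-wx

    encodes-spoke : ∀ {v} → v ≢ x → v ≢ w → v ≢ a → mem B v (hub v) ≡ true → ¬ Spoke (hub v) v →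
      Encodes B decode v v (hub v)
    encodes-spoke v≢x v≢w v≢a spoke∈B ¬flipped =
      spoke∈B , decode-spoke (proj₁ ¬xw) (refl , v≢a) , decode-spoke-flipped (proj₂ ¬xw) ¬flipped (refl , v≢a)
      where ¬xw = ¬XW v≢x v≢w

    encodes-other : ∀ {p q} → p ≢ x → p ≢ w → ¬ Spoke p q → ¬ Spoke q p → mem B p q ≡ true →
      Encodes B decode s p q
    encodes-other p≢x p≢w ¬pq ¬qp pq∈B =
      pq∈B , decode-other (proj₁ ¬xw) ¬pq ¬qp , decode-other (proj₂ ¬xw) ¬qp ¬pq
      where ¬xw = ¬XW p≢x p≢w

    n∸2≤size : mem B x w ≡ true →
      (∀ {v} → v ≢ x → v ≢ w → v ≢ a → v ≢ s → mem B v (hub v) ≡ true) →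
      (∀ {v} → v ≢ a → v ≢ s → v ≡ b ⊎ v ≡ d → mem B v a ≡ true) →
      (∃₂ λ e₁ e₂ → Encodes B decode s e₁ e₂) → n ∸ 2 ≤ size B
    n∸2≤size xw∈B spoke∈B to-a (e₁ , e₂ , special) =
      subst (_≤ size B) (countB-all-but-two (mem⇒≢ B xw∈B)) (countB≤size B S decode f₁ f₂ encodes)
      where
      S : Fin n → Bool
      S = ((λ _ → true) ─ x) ─ w
      -- a is charged to xw, s to the given edge, and every other v to its spoke
      f₁ f₂ : Fin n → Fin n
      f₁ v = if does (v ≟ a) then x else if does (v ≟ s) then e₁ else v
      f₂ v = if does (v ≟ a) then w else if does (v ≟ s) then e₂ else hub v

      -- hub (hub v) = v would put v in {b, d}, whose hubs are a
      ¬flipped : ∀ {v} → v ≢ a → v ≢ s → ¬ Spoke (hub v) v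
      ¬flipped {v} v≢a v≢s (v≡hub-hub , hub≢a) with hub-range (hub v)
      ... | inj₁ hub-hub≡a        = v≢a (trans v≡hub-hub hub-hub≡a)
      ... | inj₂ (inj₁ hub-hub≡b) = hub≢a (hub-a (to-a v≢a v≢s (inj₁ (trans v≡hub-hub hub-hub≡b))))
      ... | inj₂ (inj₂ hub-hub≡d) = hub≢a (hub-a (to-a v≢a v≢s (inj₂ (trans v≡hub-hub hub-hub≡d))))

      encodes : ∀ v → S v ≡ true → Encodes B decode v (f₁ v) (f₂ v)
      encodes v Sv with v ≟ a | v ≟ s
      ... | yes refl | _        = encodes-xw xw∈B
      ... | no  _    | yes refl = special
      ... | no  v≢a  | no  v≢s  = encodes-spoke v≢x v≢w v≢a (spoke∈B v≢x v≢w v≢a v≢s) (¬flipped v≢a v≢s)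
        where
        v∈S : ((λ _ → true) ─ x) v ≡ true × v ≢ w
        v∈S = Equivalence.to (─-true ((λ _ → true) ─ x) {w} {v}) Sv
        v≢x : v ≢ x
        v≢x = proj₂ (Equivalence.to (─-true (λ _ → true) {x} {v}) (proj₁ v∈S))
        v≢w : v ≢ w
        v≢w = proj₂ v∈S

-- The configuration around x and w

module Setting {n} (7≤n : 7 ≤ n) (G : Graph n) (regular : Regular G (n ∸ 3))
  (B : EdgeSet G) (bondage : IsRomanBondageSet G B)
  {x w : Fin n} (xw∈B : mem B x w ≡ true)
  (only-w : ∀ {y} → mem B x y ≡ true → y ≡ w) (only-x : ∀ {y} → mem B w y ≡ true → y ≡ x) where

  open CoRegular (≤-trans (s≤s (s≤s (s≤s z≤n))) 7≤n) G regular public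

  common : ∀ {u v} → u ≢ v → ∃ λ z → Missing B u z × Missing B v z
  common = common-missing B (≤-trans (s≤s (s≤s (s≤s (s≤s z≤n)))) 7≤n) twoNonNeighbours bondage

  missing-irrefl : ∀ {v} → ¬ Missing B v v
  missing-irrefl (inj₁ (v≢v , _)) = v≢v refl
  missing-irrefl (inj₂ vv∈B)      = mem⇒≢ B vv∈B refl

  missing-cases : ∀ {v p q z} → p ≢ q → NonNeighbour G v p → NonNeighbour G v q → Missing B v z →
    z ≡ p ⊎ z ≡ q ⊎ mem B v z ≡ true
  missing-cases p≢q nn-p nn-q (inj₁ nn-z) = Data.Sum.map₂ inj₁ (nonNeighbour-either p≢q nn-p nn-q nn-z)
  missing-cases p≢q nn-p nn-q (inj₂ vz∈B) = inj₂ (inj₂ vz∈B)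

  missing⇒mem : ∀ {u v p q} → p ≢ q → u ≢ p → u ≢ q → NonNeighbour G v p → NonNeighbour G v q →
    Missing B u v → mem B u v ≡ true
  missing⇒mem p≢q u≢p u≢q nn-p nn-q (inj₁ (u≢v , uv)) =
    ⊥-elim (no-three-nonNeighbours p≢q (≢-sym u≢p) (≢-sym u≢q) nn-p nn-q (nonNeighbour-sym G (u≢v , uv)))
  missing⇒mem _ _ _ _ _ (inj₂ uv∈B) = uv∈B

  x≢w : x ≢ w
  x≢w = mem⇒≢ B xw∈B

  mem⇒≢x,w : ∀ {y t} → y ≢ x → y ≢ w → mem B y t ≡ true → t ≢ x × t ≢ w
  mem⇒≢x,w {y} y≢x y≢w yt∈B = (λ { refl → y≢w (only-w (trans (memSym B x y) yt∈B)) })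
                            , (λ { refl → y≢x (only-x (trans (memSym B w y) yt∈B)) })

  common-nonNeighbour : ∃ λ a → NonNeighbour G x a × NonNeighbour G w a
  common-nonNeighbour with common x≢w
  ... | a , inj₁ nn-xa , inj₁ nn-wa = a , nn-xa , nn-wa
  ... | a , inj₂ xa∈B  , missing-wa = ⊥-elim (missing-irrefl (subst (Missing B w) (only-w xa∈B) missing-wa))
  ... | a , missing-xa , inj₂ wa∈B  = ⊥-elim (missing-irrefl (subst (Missing B x) (only-x wa∈B) missing-xa))

  module Configuration {a b d : Fin n} (a≢b : a ≢ b) (nn-xa : NonNeighbour G x a) (nn-xb : NonNeighbour G x b)
    (a≢d : a ≢ d) (nn-wa : NonNeighbour G w a) (nn-wd : NonNeighbour G w d) where

    a≢x : a ≢ x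
    a≢x = ≢-sym (proj₁ nn-xa)

    a≢w : a ≢ w
    a≢w = ≢-sym (proj₁ nn-wa)

    b≢w : b ≢ w
    b≢w = ≢-sym (adjacent-nonNeighbour-≢ G (sub B x w xw∈B) nn-xb)

    b≢x : b ≢ x
    b≢x = ≢-sym (proj₁ nn-xb)

    d≢w : d ≢ w
    d≢w = ≢-sym (proj₁ nn-wd)

    d≢x : d ≢ x
    d≢x = ≢-sym (adjacent-nonNeighbour-≢ G (sub B w x (trans (memSym B w x) xw∈B)) nn-wd)

    nn-ax : NonNeighbour G a x
    nn-ax = nonNeighbour-sym G nn-xa

    nn-aw : NonNeighbour G a w
    nn-aw = nonNeighbour-sym G nn-wa

    missing-x : ∀ {t} → Missing B x t → t ≡ a ⊎ t ≡ b ⊎ t ≡ w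
    missing-x missing = Data.Sum.map₂ (Data.Sum.map₂ only-w) (missing-cases a≢b nn-xa nn-xb missing)

    missing-w : ∀ {t} → Missing B w t → t ≡ a ⊎ t ≡ d ⊎ t ≡ x
    missing-w missing = Data.Sum.map₂ (Data.Sum.map₂ only-x) (missing-cases a≢d nn-wa nn-wd missing)

    record Other (y : Fin n) : Set where
      field
        y≢x : y ≢ x
        y≢w : y ≢ w
        y≢a : y ≢ a
        y≢b : y ≢ b
        y≢d : y ≢ d

    other? : ∀ y → Dec (Other y)
    other? y = map′ (λ (y≢x , y≢w , y≢a , y≢b , y≢d) →
                       record { y≢x = y≢x ; y≢w = y≢w ; y≢a = y≢a ; y≢b = y≢b ; y≢d = y≢d })
                    (λ o → Other.y≢x o , Other.y≢w o , Other.y≢a o , Other.y≢b o , Other.y≢d o)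
                    (¬? (y ≟ x) ×-dec ¬? (y ≟ w) ×-dec ¬? (y ≟ a) ×-dec ¬? (y ≟ b) ×-dec ¬? (y ≟ d))

    ∉⇒other : ∀ {y} → y ∉ x ∷ w ∷ a ∷ b ∷ d ∷ [] → Other y
    ∉⇒other y∉ = record
      { y≢x = y∉ ∘ here
      ; y≢w = y∉ ∘ there ∘ here
      ; y≢a = y∉ ∘ there ∘ there ∘ here
      ; y≢b = y∉ ∘ there ∘ there ∘ there ∘ here
      ; y≢d = y∉ ∘ there ∘ there ∘ there ∘ there ∘ here
      }

    module _ {y} (other : Other y) where
      open Other other

      ¬missing-x : ¬ Missing B y x
      ¬missing-x missing with missing-x (missing-sym B missing)
      ... | inj₁ y≡a        = y≢a y≡a
      ... | inj₂ (inj₁ y≡b) = y≢b y≡b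
      ... | inj₂ (inj₂ y≡w) = y≢w y≡w

      ¬missing-w : ¬ Missing B y w
      ¬missing-w missing with missing-w (missing-sym B missing)
      ... | inj₁ y≡a        = y≢a y≡a
      ... | inj₂ (inj₁ y≡d) = y≢d y≡d
      ... | inj₂ (inj₂ y≡x) = y≢x y≡x

      missing-a⇒mem : Missing B y a → mem B y a ≡ true
      missing-a⇒mem = missing⇒mem x≢w y≢x y≢w nn-ax nn-aw

      mem-a-or-missing-b : mem B y a ≡ true ⊎ Missing B y b
      mem-a-or-missing-b with common (≢-sym y≢x)
      ... | t , missing-xt , missing-yt with missing-x missing-xt
      ...   | inj₁ refl        = inj₁ (missing-a⇒mem missing-yt)
      ...   | inj₂ (inj₁ refl) = inj₂ missing-yt
      ...   | inj₂ (inj₂ refl) = ⊥-elim (¬missing-w missing-yt)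

      mem-a-or-missing-d : mem B y a ≡ true ⊎ Missing B y d
      mem-a-or-missing-d with common (≢-sym y≢w)
      ... | t , missing-wt , missing-yt with missing-w missing-wt
      ...   | inj₁ refl        = inj₁ (missing-a⇒mem missing-yt)
      ...   | inj₂ (inj₁ refl) = inj₂ missing-yt
      ...   | inj₂ (inj₂ refl) = ⊥-elim (¬missing-x missing-yt)

    module DistinctPartners (b≢d : b ≢ d) where
      open Spokes B x w a b d

      ba∈B : mem B b a ≡ true
      ba∈B with common (≢-sym b≢x)
      ... | t , missing-xt , missing-bt with missing-x missing-xt
      ...   | inj₁ refl        = missing⇒mem x≢w b≢x b≢w nn-ax nn-aw missing-bt
      ...   | inj₂ (inj₁ refl) = ⊥-elim (missing-irrefl missing-bt)
      ...   | inj₂ (inj₂ refl) with missing-w (missing-sym B missing-bt)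
      ...     | inj₁ b≡a        = ⊥-elim (a≢b (≡.sym b≡a))
      ...     | inj₂ (inj₁ b≡d) = ⊥-elim (b≢d b≡d)
      ...     | inj₂ (inj₂ b≡x) = ⊥-elim (b≢x b≡x)

      da∈B : mem B d a ≡ true
      da∈B with common (≢-sym d≢w)
      ... | t , missing-wt , missing-dt with missing-w missing-wt
      ...   | inj₁ refl        = missing⇒mem x≢w d≢x d≢w nn-ax nn-aw missing-dt
      ...   | inj₂ (inj₁ refl) = ⊥-elim (missing-irrefl missing-dt)
      ...   | inj₂ (inj₂ refl) with missing-x (missing-sym B missing-dt)
      ...     | inj₁ d≡a        = ⊥-elim (a≢d (≡.sym d≡a))
      ...     | inj₂ (inj₁ d≡b) = ⊥-elim (b≢d (≡.sym d≡b))
      ...     | inj₂ (inj₂ d≡w) = ⊥-elim (d≢w d≡w)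

      Detached : Fin n → Set
      Detached v = mem B v a ≡ false × mem B v b ≡ false

      hub≢d : ∀ {p} → ¬ Detached p → hub p ≢ d
      hub≢d {p} attached with mem B p a | mem B p b
      ... | true  | _     = a≢d
      ... | false | true  = b≢d
      ... | false | false = ⊥-elim (attached (refl , refl))

      detached-nn-b : ∀ {v} → Other v → Detached v → NonNeighbour G b v
      detached-nn-b other (va∉B , vb∉B) with mem-a-or-missing-b other
      ... | inj₁ va∈B      = ⊥-elim (≡true⇒≢false va∈B va∉B)
      ... | inj₂ missing-vb = nonNeighbour-sym G (missing⇒nonNeighbour B missing-vb vb∉B)

      -- b already misses x, so it misses at most one detached vertex
      detached-unique : ∀ {u v} → Other u → Other v → Detached u → Detached v → u ≡ v
      detached-unique {u} {v} other-u other-v detached-u detached-v with u ≟ v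
      ... | yes u≡v = u≡v
      ... | no  u≢v = ⊥-elim (no-three-nonNeighbours (≢-sym (Other.y≢x other-u)) (≢-sym (Other.y≢x other-v)) u≢v
                        (nonNeighbour-sym G nn-xb)
                        (detached-nn-b other-u detached-u) (detached-nn-b other-v detached-v))

      -- the only possible vertex without a spoke
      record Lonely (v : Fin n) : Set where
        field
          v≢x  : v ≢ x
          v≢w  : v ≢ w
          v≢a  : v ≢ a
          va∉B : mem B v a ≡ false
          vb∉B : mem B v b ≡ false
          vd∉B : mem B v d ≡ false

      lonely? : ∀ v → Dec (Lonely v)
      lonely? v = map′ (λ (v≢x , v≢w , v≢a , va∉B , vb∉B , vd∉B) → record
                          { v≢x = v≢x ; v≢w = v≢w ; v≢a = v≢a ; va∉B = va∉B ; vb∉B = vb∉B ; vd∉B = vd∉B })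
                       (λ l → Lonely.v≢x l , Lonely.v≢w l , Lonely.v≢a l , Lonely.va∉B l , Lonely.vb∉B l , Lonely.vd∉B l)
                       (¬? (v ≟ x) ×-dec ¬? (v ≟ w) ×-dec ¬? (v ≟ a) ×-dec (mem B v a Data.Bool.≟ false)
                          ×-dec (mem B v b Data.Bool.≟ false) ×-dec (mem B v d Data.Bool.≟ false))

      lonely-other : ∀ {v} → Lonely v → Other v
      lonely-other lonely = record
        { y≢x = v≢x ; y≢w = v≢w ; y≢a = v≢a
        ; y≢b = λ { refl → ≡true⇒≢false ba∈B va∉B }
        ; y≢d = λ { refl → ≡true⇒≢false da∈B va∉B }
        }
        where open Lonely lonely

      lonely-detached : ∀ {v} → Lonely v → Detached v
      lonely-detached lonely = Lonely.va∉B lonely , Lonely.vb∉B lonely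

      lonely-unique : ∀ {u v} → Lonely u → Lonely v → u ≡ v
      lonely-unique lonely-u lonely-v =
        detached-unique (lonely-other lonely-u) (lonely-other lonely-v) (lonely-detached lonely-u) (lonely-detached lonely-v)

      module _ {y₀} (lonely : Lonely y₀) where
        other-y₀ : Other y₀
        other-y₀ = lonely-other lonely
        open Other other-y₀ renaming (y≢x to y₀≢x; y≢w to y₀≢w; y≢a to y₀≢a; y≢b to y₀≢b; y≢d to y₀≢d)

        open Lonely lonely renaming (va∉B to y₀a∉B; vb∉B to y₀b∉B; vd∉B to y₀d∉B)

        nn-by₀ : NonNeighbour G b y₀
        nn-by₀ = detached-nn-b other-y₀ (lonely-detached lonely)

        nn-dy₀ : NonNeighbour G d y₀
        nn-dy₀ with mem-a-or-missing-d other-y₀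
        ... | inj₁ y₀a∈B     = ⊥-elim (≡true⇒≢false y₀a∈B y₀a∉B)
        ... | inj₂ missing-y₀d = nonNeighbour-sym G (missing⇒nonNeighbour B missing-y₀d y₀d∉B)

        module _ {y₁} (other-y₁ : Other y₁) (y₁≢y₀ : y₁ ≢ y₀) where
          open Other other-y₁ renaming (y≢x to y₁≢x; y≢w to y₁≢w; y≢a to y₁≢a; y≢b to y₁≢b; y≢d to y₁≢d)

          special-edge-at : ∀ {c} → mem B y₁ c ≡ true → hub y₁ ≢ c → ∃₂ λ e₁ e₂ → Encodes B (decode y₀) y₀ e₁ e₂
          special-edge-at y₁c∈B hub≢c =
            _ , _ , encodes-other y₀ y₁≢x y₁≢w (¬spoke-to hub≢c) (¬spoke-to-other y₁≢a y₁≢b y₁≢d) y₁c∈B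

          y₁b∈B : Missing B y₁ b → mem B y₁ b ≡ true
          y₁b∈B = missing⇒mem (≢-sym y₀≢x) y₁≢x y₁≢y₀ (nonNeighbour-sym G nn-xb) nn-by₀

          y₁d∈B : Missing B y₁ d → mem B y₁ d ≡ true
          y₁d∈B = missing⇒mem (≢-sym y₀≢w) y₁≢w y₁≢y₀ (nonNeighbour-sym G nn-wd) nn-dy₀

          special-edge-via-b : mem B y₁ b ≡ true → ∃₂ λ e₁ e₂ → Encodes B (decode y₀) y₀ e₁ e₂
          special-edge-via-b y₁b∈B′ with mem B y₁ a in y₁a
          ... | true  = special-edge-at y₁b∈B′ (λ hub≡b → a≢b (trans (≡.sym (hub-a y₁a)) hub≡b))
          ... | false with mem-a-or-missing-d other-y₁
          ...   | inj₁ y₁a∈B      = ⊥-elim (≡true⇒≢false y₁a∈B y₁a)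
          ...   | inj₂ missing-y₁d =
                    special-edge-at (y₁d∈B missing-y₁d) (hub≢d (λ (_ , y₁b∉B) → ≡true⇒≢false y₁b∈B′ y₁b∉B))

          special-edge-via-y₁ : ∃₂ λ e₁ e₂ → Encodes B (decode y₀) y₀ e₁ e₂
          special-edge-via-y₁ with common (≢-sym y₁≢y₀)
          ... | t , missing-y₀t , missing-y₁t
                with missing-cases b≢d (nonNeighbour-sym G nn-by₀) (nonNeighbour-sym G nn-dy₀) missing-y₀t
          ...   | inj₁ refl        = special-edge-via-b (y₁b∈B missing-y₁t)
          ...   | inj₂ (inj₁ refl) = special-edge-at (y₁d∈B missing-y₁t)
                    (hub≢d λ detached → y₁≢y₀ (detached-unique other-y₁ other-y₀ detached (lonely-detached lonely)))
          ...   | inj₂ (inj₂ y₀t∈B) =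
                    y₀ , t , encodes-other y₀ y₀≢x y₀≢w (¬spoke-to hub≢t) (¬spoke-to-other y₀≢a y₀≢b y₀≢d) y₀t∈B
            where
            hub≢t : hub y₀ ≢ t
            hub≢t hub≡t =
              ≡true⇒≢false (subst (λ c → mem B y₀ c ≡ true) (trans (≡.sym hub≡t) (hub-d y₀a∉B y₀b∉B)) y₀t∈B) y₀d∉B

        special-edge : ∃₂ λ e₁ e₂ → Encodes B (decode y₀) y₀ e₁ e₂
        special-edge with fresh (y₀ ∷ x ∷ w ∷ a ∷ b ∷ d ∷ []) 7≤n
        ... | y₁ , y₁∉ = special-edge-via-y₁ (∉⇒other (y₁∉ ∘ there)) (y₁∉ ∘ here)

      partners-to-a : ∀ {s v} → v ≢ a → v ≢ s → v ≡ b ⊎ v ≡ d → mem B v a ≡ true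
      partners-to-a _ _ (inj₁ refl) = ba∈B
      partners-to-a _ _ (inj₂ refl) = da∈B

      spoke∈B : ∀ {v} → v ≢ x → v ≢ w → v ≢ a → ¬ Lonely v → mem B v (hub v) ≡ true
      spoke∈B {v} v≢x v≢w v≢a ¬lonely = hub∈B partner
        where
        partner : mem B v a ≡ true ⊎ mem B v b ≡ true ⊎ mem B v d ≡ true
        partner with mem B v a in va | mem B v b in vb | mem B v d in vd
        ... | true  | _     | _     = inj₁ refl
        ... | false | true  | _     = inj₂ (inj₁ refl)
        ... | false | false | true  = inj₂ (inj₂ refl)
        ... | false | false | false = ⊥-elim (¬lonely (record
                                        { v≢x = v≢x ; v≢w = v≢w ; v≢a = v≢a ; va∉B = va ; vb∉B = vb ; vd∉B = vd }))

      bound : n ∸ 2 ≤ size B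
      bound with any? lonely?
      ... | no  none         = n∸2≤size a xw∈B
                                 (λ v≢x v≢w v≢a _ → spoke∈B v≢x v≢w v≢a (λ lonely → none (_ , lonely)))
                                 partners-to-a (x , w , encodes-xw a xw∈B)
      ... | yes (y₀ , lonely) = n∸2≤size y₀ xw∈B
                                 (λ v≢x v≢w v≢a v≢y₀ → spoke∈B v≢x v≢w v≢a (v≢y₀ ∘ flip lonely-unique lonely))
                                 partners-to-a (special-edge lonely)

  module SharedPartner {a b : Fin n} (a≢b : a ≢ b) (nn-xa : NonNeighbour G x a) (nn-xb : NonNeighbour G x b)
    (nn-wa : NonNeighbour G w a) (nn-wb : NonNeighbour G w b) where
    open Configuration a≢b nn-xa nn-xb a≢b nn-wa nn-wb
    open Spokes B x w a b b

    nn-bx : NonNeighbour G b x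
    nn-bx = nonNeighbour-sym G nn-xb

    nn-bw : NonNeighbour G b w
    nn-bw = nonNeighbour-sym G nn-wb

    mem-a-or-b : ∀ {y} → Other y → mem B y a ≡ true ⊎ mem B y b ≡ true
    mem-a-or-b other = Data.Sum.map₂ (missing⇒mem x≢w (Other.y≢x other) (Other.y≢w other) nn-bx nn-bw)
                                     (mem-a-or-missing-b other)

    -- Some y ∉ {x, w, a, b} is joined to a in B; its non-neighbours z and z′, joined to a and to b,
    -- are non-adjacent, and then no vertex is missing from both b and z′.
    module NoSpecialEdge (ba∉B : mem B b a ≡ false)
      (exclusive : ∀ {y} → mem B y a ≡ true → mem B y b ≡ true → ⊥)
      (no-inner : ∀ {y z} → Other y → Other z → mem B y z ≡ true → ⊥) where

      missing-inside : ∀ {y z} → Other y → Other z → Missing B y z → NonNeighbour G y z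
      missing-inside _       _       (inj₁ nn)   = nn
      missing-inside other-y other-z (inj₂ yz∈B) = ⊥-elim (no-inner other-y other-z yz∈B)

      outside : ∀ {t} → t ≢ x → t ≢ w → t ≢ a → t ≢ b → Other t
      outside t≢x t≢w t≢a t≢b = record { y≢x = t≢x ; y≢w = t≢w ; y≢a = t≢a ; y≢b = t≢b ; y≢d = t≢b }

      partner-of : ∀ {c y t} → NonNeighbour G c x → NonNeighbour G c w → c ≡ a ⊎ c ≡ b → Other y →
        Missing B c t → Missing B y t → Other t × mem B t c ≡ true
      partner-of {c} {y} {t} nn-cx nn-cw c∈ab other-y missing-ct missing-yt
        with missing-cases x≢w nn-cx nn-cw missing-ct
      ... | inj₁ refl        = ⊥-elim (¬missing-x other-y missing-yt)
      ... | inj₂ (inj₁ refl) = ⊥-elim (¬missing-w other-y missing-yt)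
      ... | inj₂ (inj₂ ct∈B) = outside t≢x t≢w t≢a t≢b , trans (memSym B t c) ct∈B
        where
        t≢x = proj₁ (mem⇒≢x,w (proj₁ nn-cx) (proj₁ nn-cw) ct∈B)
        t≢w = proj₂ (mem⇒≢x,w (proj₁ nn-cx) (proj₁ nn-cw) ct∈B)
        ab∉B : ∀ {p q} → p ≡ a ⊎ p ≡ b → q ≡ a ⊎ q ≡ b → p ≢ q → mem B p q ≡ true → ⊥
        ab∉B (inj₁ refl) (inj₁ refl) p≢q _ = p≢q refl
        ab∉B (inj₂ refl) (inj₂ refl) p≢q _ = p≢q refl
        ab∉B (inj₁ refl) (inj₂ refl) _ ab∈B = ≡true⇒≢false (trans (memSym B b a) ab∈B) ba∉B
        ab∉B (inj₂ refl) (inj₁ refl) _ ba∈B = ≡true⇒≢false ba∈B ba∉B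
        t≢a : t ≢ a
        t≢a refl = ab∉B c∈ab (inj₁ refl) (mem⇒≢ B ct∈B) ct∈B
        t≢b : t ≢ b
        t≢b refl = ab∉B c∈ab (inj₂ refl) (mem⇒≢ B ct∈B) ct∈B

      partner-a : ∀ {y} → Other y → ∃ λ z → Other z × mem B z a ≡ true × NonNeighbour G y z
      partner-a other-y with common (≢-sym (Other.y≢a other-y))
      ... | z , missing-az , missing-yz with partner-of nn-ax nn-aw (inj₁ refl) other-y missing-az missing-yz
      ...   | other-z , za∈B = z , other-z , za∈B , missing-inside other-y other-z missing-yz

      partner-b : ∀ {y} → Other y → ∃ λ z → Other z × mem B z b ≡ true × NonNeighbour G y z
      partner-b other-y with common (≢-sym (Other.y≢b other-y))
      ... | z , missing-bz , missing-yz with partner-of nn-bx nn-bw (inj₂ refl) other-y missing-bz missing-yz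
      ...   | other-z , zb∈B = z , other-z , zb∈B , missing-inside other-y other-z missing-yz

      partners-nonAdjacent : ∀ {y z z′} → Other y → Other z → Other z′ → mem B y a ≡ true → mem B z′ b ≡ true →
        z ≢ z′ → NonNeighbour G y z → NonNeighbour G y z′ → NonNeighbour G z′ z
      partners-nonAdjacent {y} {z} {z′} other-y other-z other-z′ ya∈B z′b∈B z≢z′ nn-yz nn-yz′
        with common (proj₁ nn-yz′)
      ... | t , missing-yt , missing-z′t with missing-cases z≢z′ nn-yz nn-yz′ missing-yt
      ...   | inj₁ refl        = missing-inside other-z′ other-z missing-z′t
      ...   | inj₂ (inj₁ refl) = ⊥-elim (missing-irrefl missing-z′t)
      ...   | inj₂ (inj₂ yt∈B) with t ≟ a | t ≟ b
      ...     | yes refl | _        = ⊥-elim (exclusive (missing-a⇒mem other-z′ missing-z′t) z′b∈B)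
      ...     | no  _    | yes refl = ⊥-elim (exclusive ya∈B yt∈B)
      ...     | no  t≢a  | no  t≢b  = ⊥-elim (no-inner other-y (outside t≢x t≢w t≢a t≢b) yt∈B)
        where
        t≢x = proj₁ (mem⇒≢x,w (Other.y≢x other-y) (Other.y≢w other-y) yt∈B)
        t≢w = proj₂ (mem⇒≢x,w (Other.y≢x other-y) (Other.y≢w other-y) yt∈B)

      absurd-at : ∀ {y} → Other y → mem B y a ≡ true → ⊥
      absurd-at {y} other-y ya∈B with partner-a other-y | partner-b other-y
      ... | z , other-z , za∈B , nn-yz | z′ , other-z′ , z′b∈B , nn-yz′ =
        b-missing-z′ (common (≢-sym (Other.y≢b other-z′)))
        where
        z≢z′ : z ≢ z′
        z≢z′ refl = exclusive za∈B z′b∈B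
        nn-z′z : NonNeighbour G z′ z
        nn-z′z = partners-nonAdjacent other-y other-z other-z′ ya∈B z′b∈B z≢z′ nn-yz nn-yz′
        b-missing-z′ : (∃ λ t → Missing B b t × Missing B z′ t) → ⊥
        b-missing-z′ (t , missing-bt , missing-z′t)
          with partner-of nn-bx nn-bw (inj₂ refl) other-z′ missing-bt missing-z′t
             | missing-cases (proj₁ nn-yz) (nonNeighbour-sym G nn-yz′) nn-z′z missing-z′t
        ... | _       , tb∈B | inj₁ refl         = exclusive ya∈B tb∈B
        ... | _       , tb∈B | inj₂ (inj₁ refl)  = exclusive za∈B tb∈B
        ... | other-t , _    | inj₂ (inj₂ z′t∈B) = no-inner other-z′ other-t z′t∈B

      absurd : ⊥
      absurd with fresh (x ∷ w ∷ a ∷ b ∷ b ∷ []) (≤-trans (s≤s (s≤s (s≤s (s≤s (s≤s (s≤s z≤n)))))) 7≤n)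
      ... | y , y∉ with common (≢-sym (Other.y≢a (∉⇒other y∉)))
      ...   | t , missing-at , missing-yt with partner-of nn-ax nn-aw (inj₁ refl) (∉⇒other y∉) missing-at missing-yt
      ...     | other-t , ta∈B = absurd-at other-t ta∈B

    special-edge : ∃₂ λ e₁ e₂ → Encodes B (decode b) b e₁ e₂
    special-edge with mem B b a in ba
    ... | true  = b , hub b , encodes-spoke b b≢x b≢w (≢-sym a≢b) (hub∈B (inj₁ ba)) λ (_ , hub≢a) → hub≢a (hub-a ba)
    ... | false with any? (λ y → (mem B y a Data.Bool.≟ true) ×-dec (mem B y b Data.Bool.≟ true))
    ...   | yes (y , ya∈B , yb∈B) =
            y , b , encodes-other b (λ { refl → a≢w (only-w ya∈B) }) (λ { refl → a≢x (only-x ya∈B) })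
                      (¬spoke-to λ hub≡b → a≢b (trans (≡.sym (hub-a ya∈B)) hub≡b))
                      (¬spoke-to-other (mem⇒≢ B ya∈B) (mem⇒≢ B yb∈B) (mem⇒≢ B yb∈B)) yb∈B
    ...   | no none with any? (λ y → any? (λ z → other? y ×-dec other? z ×-dec (mem B y z Data.Bool.≟ true)))
    ...     | yes (y , z , other-y , other-z , yz∈B) =
              y , z , encodes-other b (Other.y≢x other-y) (Other.y≢w other-y)
                        (¬spoke-to-other (Other.y≢a other-z) (Other.y≢b other-z) (Other.y≢d other-z))
                        (¬spoke-to-other (Other.y≢a other-y) (Other.y≢b other-y) (Other.y≢d other-y)) yz∈B
    ...     | no none′ = ⊥-elim (NoSpecialEdge.absurd ba (λ ya∈B yb∈B → none (_ , ya∈B , yb∈B))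
                                   (λ other-y other-z yz∈B → none′ (_ , _ , other-y , other-z , yz∈B)))

    bound : n ∸ 2 ≤ size B
    bound = n∸2≤size b xw∈B spoke∈B (λ _ v≢b v≡b → ⊥-elim ([ v≢b , v≢b ] v≡b)) special-edge
      where
      spoke∈B : ∀ {v} → v ≢ x → v ≢ w → v ≢ a → v ≢ b → mem B v (hub v) ≡ true
      spoke∈B v≢x v≢w v≢a v≢b =
        hub∈B (Data.Sum.map₂ inj₁ (mem-a-or-b (record { y≢x = v≢x ; y≢w = v≢w ; y≢a = v≢a ; y≢b = v≢b ; y≢d = v≢b })))

  bound : n ∸ 2 ≤ size B
  bound with common-nonNeighbour
  ... | a , nn-xa , nn-wa with other-nonNeighbour nn-xa | other-nonNeighbour nn-wa
  ...   | b , a≢b , nn-xb | d , a≢d , nn-wd with b ≟ d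
  ...     | yes refl = SharedPartner.bound a≢b nn-xa nn-xb nn-wa nn-wd
  ...     | no  b≢d  = Configuration.DistinctPartners.bound a≢b nn-xa nn-xb a≢d nn-wa nn-wd b≢d

lemma4p2 : (n : ℕ) → 7 ≤ n → (G : Graph n) → Regular G (n ∸ 3) → ¬ IsK333 G →
    (B : EdgeSet G) → IsRomanBondageSet G B →
    (x w : Fin n) → adj G x w ≡ true →
    (∀ y → (mem B x y ≡ true) ⇔ (y ≡ w)) →
    (∀ y → (mem B w y ≡ true) ⇔ (y ≡ x)) →
    n ∸ 2 ≤ size B
lemma4p2 n 7≤n G regular _ B bondage x w _ B-at-x B-at-w =
  Setting.bound 7≤n G regular B bondage (Equivalence.from (B-at-x w) refl)
    (Equivalence.to (B-at-x _)) (Equivalence.to (B-at-w _))
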